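{- Let $p_1<p_2<p_3$ be odd primes with $p_2\equiv 1 \pmod{p_1}$ and $p_3\equiv 1\pmod{p_1p_2}$, let $q_2=(p_2-1)/p_1$, and let $0\le i_1\le p_1-2$, $0\le i_2\le q_2-1$, $0\le i_3\le p_1-1$ be integers. Let $u=i_1(p_2-1)+i_2p_1+i_3$. Then $$\mathcal{T}_{u+1}\Phi_{p_1p_2}=1+\sum_{a=0}^{i_1}x^{ap_2}\sum_{b\in B_a}x^{bp_1}\left(-x+x^{p_1-a}\right)-x^{i_1p_2+i_2p_1}\,\mathcal{T}_{i_3-i_1+1}(x),$$ where $B_a=\{0,\ldots,q_2-1\}$ if $a<i_1$ and $B_{i_1}=\{0,\ldots,i_2-1\}$.
   Context: $\Phi_n$ denotes the $n$-th cyclotomic polynomial. For a polynomial $h$ and integer $s\ge 1$, $\mathcal{T}_s(h)=\mathrm{rem}(h,x^s)$ is the truncation of $h$ to its terms of degree $<s$; by convention $\mathcal{T}_s(h)=0$ for $s\le 0$. In particular $\mathcal{T}_s(x)=x$ if $s\ge 2$ and $\mathcal{T}_s(x)=0$ if $s\le 1$. -}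

module Defs where

open import Data.Bool using (Bool; true; false; if_then_else_)
open import Data.Nat as ℕ using (ℕ; zero; suc; _≡ᵇ_; _<ᵇ_; _∸_)
open import Data.Nat.Divisibility using (_∣?_)
open import Data.Integer as ℤ using (ℤ; +_; _<?_)
open import Data.List using (List; []; _∷_; _++_)
open import Relation.Nullary.Decidable using (does)
open import Relation.Binary.PropositionalEquality using (_≡_)

-- Formal power series with integer coefficients, given by their
-- coefficient function (coefficient of x^k).  Polynomials are the
-- series with finitely many nonzero coefficients.
Series : Set
Series = ℕ → ℤ

_≈S_ : Series → Series → Set
f ≈S g = ∀ k → f k ≡ g k

0S : Series
0S _ = + 0

X^ : ℕ → Series
X^ m k = if m ≡ᵇ k then + 1 else + 0

1S : Series
1S = X^ 0

X : Series
X = X^ 1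

_+S_ : Series → Series → Series
(f +S g) k = f k ℤ.+ g k

-S_ : Series → Series
(-S f) k = ℤ.- (f k)

_-S_ : Series → Series → Series
f -S g = f +S (-S g)

sumℤ : ℕ → (ℕ → ℤ) → ℤ
sumℤ zero    a = + 0
sumℤ (suc n) a = sumℤ n a ℤ.+ a n

_*S_ : Series → Series → Series
(f *S g) k = sumℤ (suc k) (λ i → f i ℤ.* g (k ∸ i))

sumS : ℕ → (ℕ → Series) → Series
sumS zero    F = 0S
sumS (suc n) F = sumS n F +S F n

prodS : ℕ → (ℕ → Series) → Series
prodS zero    F = 1S
prodS (suc n) F = prodS n F *S F n

nth : List ℤ → ℕ → ℤ
nth []       _       = + 0
nth (x ∷ xs) zero    = x
nth (x ∷ xs) (suc k) = nth xs k

-- Division of series f / g for g with constant term ±1 (the only case used):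
-- q_k = g_0 · (f_k − Σ_{1≤j≤k} g_j q_{k−j}).  When g divides f as a
-- polynomial, this is the polynomial quotient.
divCoeffs : Series → Series → ℕ → List ℤ
divCoeffs f g zero    = []
divCoeffs f g (suc k) =
  let qs = divCoeffs f g k in
  qs ++ (g 0 ℤ.* (f k ℤ.- sumℤ k (λ j → g (suc j) ℤ.* nth qs (k ∸ suc j))) ∷ [])

divS : Series → Series → Series
divS f g k = nth (divCoeffs f g (suc k)) k

-- Cyclotomic polynomials, defined by x^n − 1 = Π_{d ∣ n} Φ_d, i.e.
-- Φ_n = (x^n − 1) / Π_{d ∣ n, d < n} Φ_d  (n ≥ 1).
-- cycTable n d = Φ_d for 1 ≤ d ≤ n.
cycTable : ℕ → ℕ → Series
cycTable zero    d = 0S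
cycTable (suc n) d =
  if d ≡ᵇ suc n
  then divS (X^ (suc n) -S 1S)
            (prodS n (λ i → if does (suc i ∣? suc n) then cycTable n (suc i) else 1S))
  else cycTable n d

Φ : ℕ → Series
Φ n = cycTable n n

-- truncation T_s(h) = rem(h, x^s); for s ≤ 0 it is 0.  s is an integer.
T : ℤ → Series → Series
T s h k = if does (+ k <? s) then h k else + 0

-- B_a = {0,…,q2−1} if a < i1, and B_{i1} = {0,…,i2−1}; we give its size.
Bsize : (i1 q2 i2 a : ℕ) → ℕ
Bsize i1 q2 i2 a = if a <ᵇ i1 then q2 else i2

-- Since x^{pq} - 1 = (x - 1) Φ_p Φ_q Φ_pq and Φ_p = 1 + x + ... + x^{p-1}, modulo x^{pq} the
-- polynomial Φ_pq is the power series (1 - x) / ((1 - x^p) (1 - x^q)).  When q = q₂ p + 1 this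
-- series equals h = Σ_k x^{kp} - x (Σ_{j<q₂} x^{jp}) Σ_k x^{kq}.  With M = i₁ q₂ + i₂ we have
-- u = M p + i₃, and the terms of h of degree ≤ u are 1 + x^p + ... + x^{Mp}, the terms
-- -x^{1 + a q + b p} for a < i₁, b < q₂ and for a = i₁, b < i₂, and -x^{1 + i₁ q + i₂ p} if
-- i₃ > i₁.  As a q + p - a = (a q₂ + 1) p, grouping them by a gives the right-hand side.

module Submission where

open import Defs
open import Level using (0ℓ)
open import Algebra.Bundles using (CommutativeRing)
import Algebra.Properties.CommutativeSemigroup as CommutativeSemigroupProperties
import Algebra.Solver.Ring.AlmostCommutativeRing as ACR
open import Data.Bool using (true; false; if_then_else_)
open import Data.Empty using (⊥-elim)
open import Data.Integer as ℤ using (ℤ; +_)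
import Data.Integer.Properties as ℤP
import Data.Integer.Tactic.RingSolver as ℤ-Ring
open import Data.List using (List; []; _∷_; _++_; length)
open import Data.List.Properties using (length-++)
open import Data.Maybe using (Maybe; just; nothing)
open import Data.Nat using (ℕ; zero; suc; _+_; _*_; _∸_; _≤_; _<_; z≤n; s≤s)
import Data.Nat as ℕ
import Data.Nat.Induction as ℕI
import Data.Nat.Properties as ℕP
import Data.Nat.Tactic.RingSolver as ℕ-Ring
open import Data.Nat.Coprimality using (Coprime; coprime-divisor)
open import Data.Nat.Divisibility
  using (_∣_; _∣?_; divides; _∣0; ∣-refl; ∣⇒≤; ∣m+n∣m⇒∣n; ∣m∸n∣n⇒∣m; *-cancelʳ-∣)
open import Data.Nat.Primality using (Prime; prime⇒irreducible; prime⇒nonZero; prime⇒nonTrivial)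
open import Data.Product using (_,_)
open import Data.Sum using (_⊎_; inj₁; inj₂; [_,_])
open import Function using (_∘_)
open import Induction.WellFounded using (Acc; acc)
open import Relation.Binary.PropositionalEquality
  using (_≡_; _≢_; refl; sym; trans; cong; cong₂; subst; module ≡-Reasoning)
import Relation.Binary.Reasoning.Setoid as SetoidReasoning
open import Relation.Nullary using (¬_; yes; no; does)
open import Relation.Nullary.Decidable using (dec-true; dec-false)

open CommutativeSemigroupProperties ℤP.+-commutativeSemigroup using (interchange)

sumℤ-cong : ∀ n {a b : ℕ → ℤ} → (∀ i → i < n → a i ≡ b i) → sumℤ n a ≡ sumℤ n b
sumℤ-cong zero    _   = refl
sumℤ-cong (suc n) a≡b =
  cong₂ ℤ._+_ (sumℤ-cong n (λ i i<n → a≡b i (ℕP.m<n⇒m<1+n i<n))) (a≡b n ℕP.≤-refl)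

sumℤ-ext : ∀ n {a b : ℕ → ℤ} → (∀ i → a i ≡ b i) → sumℤ n a ≡ sumℤ n b
sumℤ-ext n a≡b = sumℤ-cong n (λ i _ → a≡b i)

sumℤ-zero : ∀ n {a : ℕ → ℤ} → (∀ i → i < n → a i ≡ + 0) → sumℤ n a ≡ + 0
sumℤ-zero zero    _   = refl
sumℤ-zero (suc n) a≡0 =
  cong₂ ℤ._+_ (sumℤ-zero n (λ i i<n → a≡0 i (ℕP.m<n⇒m<1+n i<n))) (a≡0 n ℕP.≤-refl)

sumℤ-+ : ∀ n (a b : ℕ → ℤ) → sumℤ n (λ i → a i ℤ.+ b i) ≡ sumℤ n a ℤ.+ sumℤ n b
sumℤ-+ zero    a b = refl
sumℤ-+ (suc n) a b =
  trans (cong (ℤ._+ (a n ℤ.+ b n)) (sumℤ-+ n a b)) (interchange (sumℤ n a) (sumℤ n b) (a n) (b n))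

sumℤ-*ˡ : ∀ n c (a : ℕ → ℤ) → sumℤ n (λ i → c ℤ.* a i) ≡ c ℤ.* sumℤ n a
sumℤ-*ˡ zero    c a = sym (ℤP.*-zeroʳ c)
sumℤ-*ˡ (suc n) c a =
  trans (cong (ℤ._+ c ℤ.* a n) (sumℤ-*ˡ n c a)) (sym (ℤP.*-distribˡ-+ c (sumℤ n a) (a n)))

sumℤ-*ʳ : ∀ n c (a : ℕ → ℤ) → sumℤ n (λ i → a i ℤ.* c) ≡ sumℤ n a ℤ.* c
sumℤ-*ʳ zero    c a = sym (ℤP.*-zeroˡ c)
sumℤ-*ʳ (suc n) c a =
  trans (cong (ℤ._+ a n ℤ.* c) (sumℤ-*ʳ n c a)) (sym (ℤP.*-distribʳ-+ c (sumℤ n a) (a n)))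

sumℤ-unconsˡ : ∀ n (a : ℕ → ℤ) → sumℤ (suc n) a ≡ a 0 ℤ.+ sumℤ n (λ i → a (suc i))
sumℤ-unconsˡ zero    a = ℤP.+-comm (+ 0) (a 0)
sumℤ-unconsˡ (suc n) a =
  trans (cong (ℤ._+ a (suc n)) (sumℤ-unconsˡ n a)) (ℤP.+-assoc (a 0) _ _)

sumℤ-reverse : ∀ k (a : ℕ → ℤ) → sumℤ (suc k) (λ i → a (k ∸ i)) ≡ sumℤ (suc k) a
sumℤ-reverse zero    a = refl
sumℤ-reverse (suc k) a = begin
  sumℤ (suc (suc k)) (λ i → a (suc k ∸ i))  ≡⟨ sumℤ-unconsˡ (suc k) (λ i → a (suc k ∸ i)) ⟩
  a (suc k) ℤ.+ sumℤ (suc k) (λ i → a (k ∸ i)) ≡⟨ cong (ℤ._+_ (a (suc k))) (sumℤ-reverse k a) ⟩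
  a (suc k) ℤ.+ sumℤ (suc k) a                ≡⟨ ℤP.+-comm (a (suc k)) _ ⟩
  sumℤ (suc (suc k)) a                        ∎
  where open ≡-Reasoning

sumℤ-triangle : ∀ n (F : ℕ → ℕ → ℤ) →
  sumℤ (suc n) (λ i → sumℤ (suc i) (λ j → F j i)) ≡
  sumℤ (suc n) (λ j → sumℤ (suc (n ∸ j)) (λ l → F j (j + l)))
sumℤ-triangle zero    F = refl
sumℤ-triangle (suc n) F = begin
  rows n ℤ.+ sumℤ (suc (suc n)) (λ j → F j (suc n))
    ≡⟨ cong (ℤ._+ sumℤ (suc (suc n)) (λ j → F j (suc n))) (sumℤ-triangle n F) ⟩
  columns n ℤ.+ (sumℤ (suc n) (λ j → F j (suc n)) ℤ.+ F (suc n) (suc n))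
    ≡⟨ sym (ℤP.+-assoc (columns n) _ _) ⟩
  (columns n ℤ.+ sumℤ (suc n) (λ j → F j (suc n))) ℤ.+ F (suc n) (suc n)
    ≡⟨ cong₂ ℤ._+_ (trans (sym (sumℤ-+ (suc n) _ _)) (sumℤ-cong (suc n) extend)) diagonal ⟩
  columns (suc n) ∎
  where
  open ≡-Reasoning
  rows columns : ℕ → ℤ
  rows    n = sumℤ (suc n) (λ i → sumℤ (suc i) (λ j → F j i))
  columns n = sumℤ (suc n) (λ j → sumℤ (suc (n ∸ j)) (λ l → F j (j + l)))
  extend : ∀ j → j < suc n →
    sumℤ (suc (n ∸ j)) (λ l → F j (j + l)) ℤ.+ F j (suc n) ≡ sumℤ (suc (suc n ∸ j)) (λ l → F j (j + l))
  extend j (s≤s j≤n) rewrite ℕP.+-∸-assoc 1 j≤n =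
    cong (λ m → sumℤ (suc (n ∸ j)) (λ l → F j (j + l)) ℤ.+ F j m)
         (sym (trans (ℕP.+-suc j (n ∸ j)) (cong suc (ℕP.m+[n∸m]≡n j≤n))))
  diagonal : F (suc n) (suc n) ≡ sumℤ (suc (n ∸ n)) (λ l → F (suc n) (suc n + l))
  diagonal rewrite ℕP.n∸n≡0 n | ℕP.+-identityʳ (suc n) = sym (ℤP.+-identityˡ _)

-- The ring of power series

≡ᵇ-refl : ∀ m → (m ℕ.≡ᵇ m) ≡ true
≡ᵇ-refl m = dec-true (m ℕ.≟ m) refl

≢⇒≡ᵇ-false : ∀ {m n} → m ≢ n → (m ℕ.≡ᵇ n) ≡ false
≢⇒≡ᵇ-false {m} {n} m≢n = dec-false (m ℕ.≟ n) m≢n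

X^-coeff-≡ : ∀ m → X^ m m ≡ + 1
X^-coeff-≡ m rewrite ≡ᵇ-refl m = refl

X^-coeff-≢ : ∀ {m k} → m ≢ k → X^ m k ≡ + 0
X^-coeff-≢ m≢k rewrite ≢⇒≡ᵇ-false m≢k = refl

sumℤ-X^-vanish : ∀ n m (a : ℕ → ℤ) → n ≤ m → sumℤ n (λ i → X^ m i ℤ.* a i) ≡ + 0
sumℤ-X^-vanish n m a n≤m = sumℤ-zero n (λ i i<n →
  cong (ℤ._* a i) (X^-coeff-≢ (ℕP.>⇒≢ (ℕP.<-≤-trans i<n n≤m))))

sumℤ-X^-select : ∀ n m (a : ℕ → ℤ) → m < n → sumℤ n (λ i → X^ m i ℤ.* a i) ≡ a m
sumℤ-X^-select (suc n) m a (s≤s m≤n) with ℕP.m≤n⇒m<n∨m≡n m≤n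
... | inj₁ m<n = begin
  sumℤ n (λ i → X^ m i ℤ.* a i) ℤ.+ X^ m n ℤ.* a n ≡⟨ cong₂ ℤ._+_ (sumℤ-X^-select n m a m<n)
                                                        (cong (ℤ._* a n) (X^-coeff-≢ (ℕP.<⇒≢ m<n))) ⟩
  a m ℤ.+ + 0 ℤ.* a n                               ≡⟨ ℤP.+-identityʳ (a m) ⟩
  a m ∎
  where open ≡-Reasoning
... | inj₂ refl = begin
  sumℤ m (λ i → X^ m i ℤ.* a i) ℤ.+ X^ m m ℤ.* a m ≡⟨ cong₂ ℤ._+_ (sumℤ-X^-vanish m m a ℕP.≤-refl)
                                                        (cong (ℤ._* a m) (X^-coeff-≡ m)) ⟩
  + 0 ℤ.+ + 1 ℤ.* a m                               ≡⟨ trans (ℤP.+-identityˡ _) (ℤP.*-identityˡ (a m)) ⟩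
  a m ∎
  where open ≡-Reasoning

X^-*-coeff-≥ : ∀ {m k} (f : Series) → m ≤ k → (X^ m *S f) k ≡ f (k ∸ m)
X^-*-coeff-≥ {m} {k} f m≤k = sumℤ-X^-select (suc k) m (λ i → f (k ∸ i)) (s≤s m≤k)

X^-*-coeff-< : ∀ {m k} (f : Series) → k < m → (X^ m *S f) k ≡ + 0
X^-*-coeff-< {m} {k} f k<m = sumℤ-X^-vanish (suc k) m (λ i → f (k ∸ i)) k<m

*S-comm : ∀ f g → (f *S g) ≈S (g *S f)
*S-comm f g k = trans (sym (sumℤ-reverse k (λ i → f i ℤ.* g (k ∸ i))))
  (sumℤ-cong (suc k) (λ i i≤k →
    trans (cong (λ j → f (k ∸ i) ℤ.* g j) (ℕP.m∸[m∸n]≡n (ℕP.≤-pred i≤k))) (ℤP.*-comm (f (k ∸ i)) (g i))))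

*S-cong : ∀ {f f′ g g′} → f ≈S f′ → g ≈S g′ → (f *S g) ≈S (f′ *S g′)
*S-cong f≈f′ g≈g′ k = sumℤ-ext (suc k) (λ i → cong₂ ℤ._*_ (f≈f′ i) (g≈g′ (k ∸ i)))

*S-distribˡ : ∀ f g h → (f *S (g +S h)) ≈S ((f *S g) +S (f *S h))
*S-distribˡ f g h k =
  trans (sumℤ-ext (suc k) (λ i → ℤP.*-distribˡ-+ (f i) (g (k ∸ i)) (h (k ∸ i)))) (sumℤ-+ (suc k) _ _)

*S-identityˡ : ∀ f → (1S *S f) ≈S f
*S-identityˡ f k = X^-*-coeff-≥ f z≤n

*S-assoc : ∀ f g h → ((f *S g) *S h) ≈S (f *S (g *S h))
*S-assoc f g h n = begin
  sumℤ (suc n) (λ i → sumℤ (suc i) (λ j → f j ℤ.* g (i ∸ j)) ℤ.* h (n ∸ i))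
    ≡⟨ sumℤ-ext (suc n) (λ i → sym (sumℤ-*ʳ (suc i) (h (n ∸ i)) (λ j → f j ℤ.* g (i ∸ j)))) ⟩
  sumℤ (suc n) (λ i → sumℤ (suc i) (λ j → f j ℤ.* g (i ∸ j) ℤ.* h (n ∸ i)))
    ≡⟨ sumℤ-triangle n (λ j i → f j ℤ.* g (i ∸ j) ℤ.* h (n ∸ i)) ⟩
  sumℤ (suc n) (λ j → sumℤ (suc (n ∸ j)) (λ l → f j ℤ.* g (j + l ∸ j) ℤ.* h (n ∸ (j + l))))
    ≡⟨ sumℤ-ext (suc n) (λ j → trans (sumℤ-ext (suc (n ∸ j)) (reindex j)) (sumℤ-*ˡ (suc (n ∸ j)) (f j) _)) ⟩
  sumℤ (suc n) (λ j → f j ℤ.* sumℤ (suc (n ∸ j)) (λ l → g l ℤ.* h (n ∸ j ∸ l))) ∎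
  where
  open ≡-Reasoning
  reindex : ∀ j l → f j ℤ.* g (j + l ∸ j) ℤ.* h (n ∸ (j + l)) ≡ f j ℤ.* (g l ℤ.* h (n ∸ j ∸ l))
  reindex j l = trans (ℤP.*-assoc (f j) _ _)
    (cong₂ (λ a b → f j ℤ.* (g a ℤ.* h b)) (ℕP.m+n∸m≡n j l) (sym (ℕP.∸-+-assoc n j l)))

*S-coeff-0 : ∀ f g → (f *S g) 0 ≡ f 0 ℤ.* g 0
*S-coeff-0 f g = ℤP.+-identityˡ (f 0 ℤ.* g 0)

infix 4 _≋_

-- _≈S_ wrapped in a record, so that the two series can be inferred from an equation.
record _≋_ (f g : Series) : Set where
  constructor coeffwise
  field coeff : f ≈S g
open _≋_

≋-refl : ∀ {f} → f ≋ f
≋-refl = coeffwise (λ _ → refl)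

Series-commutativeRing : CommutativeRing 0ℓ 0ℓ
Series-commutativeRing = record
  { Carrier = Series ; _≈_ = _≋_ ; _+_ = _+S_ ; _*_ = _*S_ ; -_ = -S_ ; 0# = 0S ; 1# = 1S
  ; isCommutativeRing = record
    { isRing = record
      { +-isAbelianGroup = record
        { isGroup = record
          { isMonoid = record
            { isSemigroup = record
              { isMagma = record
                { isEquivalence = record
                  { refl  = ≋-refl
                  ; sym   = λ (coeffwise e) → coeffwise (λ k → sym (e k))
                  ; trans = λ (coeffwise e) (coeffwise e′) → coeffwise (λ k → trans (e k) (e′ k)) }
                ; ∙-cong = λ (coeffwise e) (coeffwise e′) → coeffwise (λ k → cong₂ ℤ._+_ (e k) (e′ k)) }
              ; assoc = λ f g h → coeffwise (λ k → ℤP.+-assoc (f k) (g k) (h k)) }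
            ; identity = (λ f → coeffwise (λ k → ℤP.+-identityˡ (f k)))
                       , (λ f → coeffwise (λ k → ℤP.+-identityʳ (f k))) }
          ; inverse = (λ f → coeffwise (λ k → ℤP.+-inverseˡ (f k)))
                    , (λ f → coeffwise (λ k → ℤP.+-inverseʳ (f k)))
          ; ⁻¹-cong = λ (coeffwise e) → coeffwise (λ k → cong ℤ.-_ (e k)) }
        ; comm = λ f g → coeffwise (λ k → ℤP.+-comm (f k) (g k)) }
      ; *-cong = λ (coeffwise e) (coeffwise e′) → coeffwise (*S-cong e e′)
      ; *-assoc = λ f g h → coeffwise (*S-assoc f g h)
      ; *-identity = (λ f → coeffwise (*S-identityˡ f))
                   , (λ f → coeffwise (λ k → trans (*S-comm f 1S k) (*S-identityˡ f k)))
      ; distrib = (λ f g h → coeffwise (*S-distribˡ f g h))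
                , (λ f g h → coeffwise (λ k → trans (*S-comm (g +S h) f k)
                     (trans (*S-distribˡ f g h k) (cong₂ ℤ._+_ (*S-comm f g k) (*S-comm f h k)))))
      }
    ; *-comm = λ f g → coeffwise (*S-comm f g)
    }
  }

open CommutativeRing Series-commutativeRing
  using ( +-cong; +-identityˡ; +-identityʳ; -‿cong; -‿inverseʳ;
         *-cong; *-assoc; *-identityˡ; *-identityʳ; zeroˡ; zeroʳ)
  renaming (setoid to ≋-setoid; sym to ≋-sym; trans to ≋-trans)

module ≋-Reasoning = SetoidReasoning ≋-setoid

-- by cases on k, so that the solver's con (+ 1) is 1S definitionally
const : ℤ → Series
const c k = if 0 ℕ.≡ᵇ k then c else + 0

const-as-X^ : ∀ c k → const c k ≡ c ℤ.* X^ 0 k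
const-as-X^ c zero    = sym (ℤP.*-identityʳ c)
const-as-X^ c (suc k) = sym (ℤP.*-zeroʳ c)

const-* : ∀ a b → const (a ℤ.* b) ≋ (const a *S const b)
const-* a b = coeffwise λ k → sym (begin
  sumℤ (suc k) (λ i → const a i ℤ.* const b (k ∸ i))
    ≡⟨ sumℤ-ext (suc k) (λ i → trans (cong₂ ℤ._*_ (const-as-X^ a i) (const-as-X^ b (k ∸ i)))
                                      (shuffle a b (X^ 0 i) (X^ 0 (k ∸ i)))) ⟩
  sumℤ (suc k) (λ i → X^ 0 i ℤ.* (a ℤ.* b ℤ.* X^ 0 (k ∸ i)))
    ≡⟨ sumℤ-X^-select (suc k) 0 (λ i → a ℤ.* b ℤ.* X^ 0 (k ∸ i)) (s≤s z≤n) ⟩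
  a ℤ.* b ℤ.* X^ 0 k
    ≡⟨ sym (const-as-X^ (a ℤ.* b) k) ⟩
  const (a ℤ.* b) k ∎)
  where
  open ≡-Reasoning
  shuffle : ∀ a b x y → a ℤ.* x ℤ.* (b ℤ.* y) ≡ x ℤ.* (a ℤ.* b ℤ.* y)
  shuffle = ℤ-Ring.solve-∀

const-homomorphism : ℤ.+-*-rawRing ACR.-Raw-AlmostCommutative⟶ ACR.fromCommutativeRing Series-commutativeRing
const-homomorphism = record
  { ⟦_⟧    = const
  ; +-homo = λ a b → coeffwise (λ { zero → refl ; (suc k) → refl })
  ; *-homo = const-*
  ; -‿homo = λ a → coeffwise (λ { zero → refl ; (suc k) → refl })
  ; 0-homo = coeffwise (λ { zero → refl ; (suc k) → refl })
  ; 1-homo = coeffwise (λ { zero → refl ; (suc k) → refl })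
  }

const-≟ : ∀ a b → Maybe (const a ≋ const b)
const-≟ a b with a ℤ.≟ b
... | yes refl = just ≋-refl
... | no  _    = nothing

open import Algebra.Solver.Ring ℤ.+-*-rawRing (ACR.fromCommutativeRing Series-commutativeRing)
  const-homomorphism const-≟

X^-cong : ∀ {a b} → a ≡ b → X^ a ≋ X^ b
X^-cong refl = ≋-refl

X^-shift : ∀ j m k → X^ (j + m) (j + k) ≡ X^ m k
X^-shift zero    m k = refl
X^-shift (suc j) m k = X^-shift j m k

X^-+ : ∀ a b → (X^ a *S X^ b) ≋ X^ (a + b)
X^-+ a b = coeffwise go
  where
  go : ∀ k → (X^ a *S X^ b) k ≡ X^ (a + b) k
  go k with a ℕ.≤? k
  ... | yes a≤k = trans (X^-*-coeff-≥ (X^ b) a≤k)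
                        (trans (sym (X^-shift a b (k ∸ a))) (cong (X^ (a + b)) (ℕP.m+[n∸m]≡n a≤k)))
  ... | no  a≰k = trans (X^-*-coeff-< (X^ b) (ℕP.≰⇒> a≰k))
                        (sym (X^-coeff-≢ (ℕP.>⇒≢ (ℕP.<-≤-trans (ℕP.≰⇒> a≰k) (ℕP.m≤m+n a b)))))

sumS-cong : ∀ n {F G : ℕ → Series} → (∀ i → i < n → F i ≋ G i) → sumS n F ≋ sumS n G
sumS-cong zero    _   = ≋-refl
sumS-cong (suc n) F≋G = +-cong (sumS-cong n (λ i i<n → F≋G i (ℕP.m<n⇒m<1+n i<n))) (F≋G n ℕP.≤-refl)

sumS-*ˡ : ∀ n c F → sumS n (λ i → c *S F i) ≋ (c *S sumS n F)
sumS-*ˡ zero    c F = ≋-sym (zeroʳ c)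
sumS-*ˡ (suc n) c F = ≋-trans (+-cong (sumS-*ˡ n c F) ≋-refl)
  (solve 3 (λ c s f → c :* s :+ c :* f := c :* (s :+ f)) ≋-refl c (sumS n F) (F n))

sumS-*ʳ : ∀ n F c → sumS n (λ i → F i *S c) ≋ (sumS n F *S c)
sumS-*ʳ zero    F c = ≋-sym (zeroˡ c)
sumS-*ʳ (suc n) F c = ≋-trans (+-cong (sumS-*ʳ n F c) ≋-refl)
  (solve 3 (λ s f c → s :* c :+ f :* c := (s :+ f) :* c) ≋-refl (sumS n F) (F n) c)

sumS-- : ∀ n F G → sumS n (λ i → F i -S G i) ≋ (sumS n F -S sumS n G)
sumS-- zero    F G = ≋-sym (-‿inverseʳ 0S)
sumS-- (suc n) F G = ≋-trans (+-cong (sumS-- n F G) ≋-refl)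
  (solve 4 (λ s t f g → (s :- t) :+ (f :- g) := (s :+ f) :- (t :+ g)) ≋-refl (sumS n F) (sumS n G) (F n) (G n))

geomSum : ℕ → ℕ → Series
geomSum n d = sumS n (λ i → X^ (i * d))

geomSum-telescope : ∀ n d → ((1S -S X^ d) *S geomSum n d) ≋ (1S -S X^ (n * d))
geomSum-telescope zero    d = ≋-trans (zeroʳ (1S -S X^ d)) (≋-sym (-‿inverseʳ 1S))
geomSum-telescope (suc n) d = begin
  (1S -S X^ d) *S (geomSum n d +S X^ (n * d))
    ≈⟨ solve 3 (λ x g y → (con (+ 1) :- x) :* (g :+ y) := ((con (+ 1) :- x) :* g :+ y) :- x :* y)
             ≋-refl (X^ d) (geomSum n d) (X^ (n * d)) ⟩
  (((1S -S X^ d) *S geomSum n d) +S X^ (n * d)) -S (X^ d *S X^ (n * d))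
    ≈⟨ +-cong (+-cong (geomSum-telescope n d) ≋-refl) (-‿cong (X^-+ d (n * d))) ⟩
  ((1S -S X^ (n * d)) +S X^ (n * d)) -S X^ (d + n * d)
    ≈⟨ solve 2 (λ y z → ((con (+ 1) :- y) :+ y) :- z := con (+ 1) :- z) ≋-refl (X^ (n * d)) (X^ (d + n * d)) ⟩
  1S -S X^ (suc n * d) ∎
  where open ≋-Reasoning

geomSum-+ : ∀ a b d → geomSum (a + b) d ≋ (geomSum a d +S (X^ (a * d) *S geomSum b d))
geomSum-+ a zero d = begin
  geomSum (a + 0) d                           ≈⟨ coeffwise (λ k → cong (λ n → geomSum n d k) (ℕP.+-identityʳ a)) ⟩
  geomSum a d                                 ≈⟨ ≋-sym (+-identityʳ (geomSum a d)) ⟩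
  geomSum a d +S 0S                           ≈⟨ +-cong (≋-refl {geomSum a d}) (≋-sym (zeroʳ (X^ (a * d)))) ⟩
  geomSum a d +S (X^ (a * d) *S geomSum 0 d) ∎
  where open ≋-Reasoning
geomSum-+ a (suc b) d = begin
  geomSum (a + suc b) d
    ≈⟨ coeffwise (λ k → cong (λ n → geomSum n d k) (ℕP.+-suc a b)) ⟩
  geomSum (a + b) d +S X^ ((a + b) * d)
    ≈⟨ +-cong (geomSum-+ a b d) (≋-trans (X^-cong (ℕP.*-distribʳ-+ d a b)) (≋-sym (X^-+ (a * d) (b * d)))) ⟩
  (geomSum a d +S (X^ (a * d) *S geomSum b d)) +S (X^ (a * d) *S X^ (b * d))
    ≈⟨ solve 4 (λ g x h y → (g :+ x :* h) :+ x :* y := g :+ x :* (h :+ y))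
             ≋-refl (geomSum a d) (X^ (a * d)) (geomSum b d) (X^ (b * d)) ⟩
  geomSum a d +S (X^ (a * d) *S geomSum (suc b) d) ∎
  where open ≋-Reasoning

geomSum-unconsˡ : ∀ n d → geomSum (suc n) d ≋ (1S +S (X^ d *S geomSum n d))
geomSum-unconsˡ n d =
  ≋-trans (geomSum-+ 1 n d) (+-cong (+-identityˡ 1S) (*-cong (X^-cong (ℕP.+-identityʳ d)) (≋-refl {geomSum n d})))

geomSum-coeff-0 : ∀ n → geomSum (suc n) 1 0 ≡ + 1
geomSum-coeff-0 n = trans (coeff (geomSum-unconsˡ n 1) 0)
                          (cong (ℤ._+_ (+ 1)) (X^-*-coeff-< {1} (geomSum n 1) (s≤s z≤n)))

geomSum-blocks : ∀ n m d → sumS n (λ a → X^ (a * m * d) *S geomSum m d) ≋ geomSum (n * m) d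
geomSum-blocks zero    m d = ≋-refl
geomSum-blocks (suc n) m d = begin
  sumS n (λ a → X^ (a * m * d) *S geomSum m d) +S (X^ (n * m * d) *S geomSum m d)
    ≈⟨ +-cong (geomSum-blocks n m d) ≋-refl ⟩
  geomSum (n * m) d +S (X^ (n * m * d) *S geomSum m d)
    ≈⟨ ≋-sym (geomSum-+ (n * m) m d) ⟩
  geomSum (n * m + m) d
    ≈⟨ coeffwise (λ k → cong (λ l → geomSum l d k) (ℕP.+-comm (n * m) m)) ⟩
  geomSum (suc n * m) d ∎
  where open ≋-Reasoning

geomSeries : ℕ → Series
geomSeries d k = if does (d ∣? k) then + 1 else + 0

geomSeries-coeff-0 : ∀ d → geomSeries d 0 ≡ + 1
geomSeries-coeff-0 d = cong (λ b → if b then + 1 else + 0) (dec-true (d ∣? 0) (d ∣0))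

geomSeries-coeff-periodic : ∀ d k → d ≤ k → geomSeries d k ≡ geomSeries d (k ∸ d)
geomSeries-coeff-periodic d k d≤k with d ∣? k | d ∣? (k ∸ d)
... | yes _   | yes _    = refl
... | no  _   | no  _    = refl
... | yes d∣k | no  d∤k-d = ⊥-elim (d∤k-d (∣m+n∣m⇒∣n (subst (d ∣_) (sym (ℕP.m+[n∸m]≡n d≤k)) d∣k) ∣-refl))
... | no  d∤k | yes d∣k-d = ⊥-elim (d∤k (∣m∸n∣n⇒∣m d d≤k d∣k-d ∣-refl))

geomSeries-coeff-gap : ∀ d k → 0 < k → k < d → geomSeries d k ≡ + 0
geomSeries-coeff-gap d k 0<k k<d =
  cong (λ b → if b then + 1 else + 0)
       (dec-false (d ∣? k) (λ d∣k → ℕP.<⇒≱ k<d (∣⇒≤ ⦃ ℕ.>-nonZero 0<k ⦄ d∣k)))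

geomSeries-inverse : ∀ {d} → 0 < d → ((1S -S X^ d) *S geomSeries d) ≋ 1S
geomSeries-inverse {d} 0<d =
  ≋-trans (solve 2 (λ x g → (con (+ 1) :- x) :* g := g :- x :* g) ≋-refl (X^ d) (geomSeries d))
          (coeffwise coeff-k)
  where
  coeff-k : ∀ k → (geomSeries d -S (X^ d *S geomSeries d)) k ≡ 1S k
  coeff-k k with d ℕ.≤? k
  ... | yes d≤k = begin
    geomSeries d k ℤ.- (X^ d *S geomSeries d) k
      ≡⟨ cong₂ ℤ._-_ (geomSeries-coeff-periodic d k d≤k) (X^-*-coeff-≥ (geomSeries d) d≤k) ⟩
    geomSeries d (k ∸ d) ℤ.- geomSeries d (k ∸ d)
      ≡⟨ ℤP.+-inverseʳ (geomSeries d (k ∸ d)) ⟩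
    + 0
      ≡⟨ sym (X^-coeff-≢ (ℕP.<⇒≢ (ℕP.<-≤-trans 0<d d≤k))) ⟩
    1S k ∎
    where open ≡-Reasoning
  ... | no d≰k = trans (cong (ℤ._-_ (geomSeries d k)) (X^-*-coeff-< (geomSeries d) (ℕP.≰⇒> d≰k))) (constant k (ℕP.≰⇒> d≰k))
    where
    constant : ∀ k → k < d → geomSeries d k ℤ.- + 0 ≡ 1S k
    constant zero    _   = cong (ℤ._- + 0) (geomSeries-coeff-0 d)
    constant (suc k) k<d = cong (ℤ._- + 0) (geomSeries-coeff-gap d (suc k) (s≤s z≤n) k<d)

geomSum-as-series : ∀ n {d} → 0 < d → geomSum n d ≋ ((1S -S X^ (n * d)) *S geomSeries d)
geomSum-as-series n {d} 0<d = begin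
  geomSum n d
    ≈⟨ ≋-sym (*-identityʳ (geomSum n d)) ⟩
  geomSum n d *S 1S
    ≈⟨ *-cong (≋-refl {geomSum n d}) (≋-sym (geomSeries-inverse 0<d)) ⟩
  geomSum n d *S ((1S -S X^ d) *S geomSeries d)
    ≈⟨ solve 3 (λ g x s → g :* (x :* s) := (x :* g) :* s) ≋-refl (geomSum n d) (1S -S X^ d) (geomSeries d) ⟩
  ((1S -S X^ d) *S geomSum n d) *S geomSeries d
    ≈⟨ *-cong (geomSum-telescope n d) (≋-refl {geomSeries d}) ⟩
  (1S -S X^ (n * d)) *S geomSeries d ∎
  where open ≋-Reasoning

geomSeries-split : ∀ n {d} → 0 < d → geomSeries d ≋ (geomSum n d +S (X^ (n * d) *S geomSeries d))
geomSeries-split n {d} 0<d = ≋-sym (begin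
  geomSum n d +S (X^ (n * d) *S geomSeries d)
    ≈⟨ +-cong (geomSum-as-series n 0<d) (≋-refl {X^ (n * d) *S geomSeries d}) ⟩
  ((1S -S X^ (n * d)) *S geomSeries d) +S (X^ (n * d) *S geomSeries d)
    ≈⟨ solve 2 (λ x s → (con (+ 1) :- x) :* s :+ x :* s := s) ≋-refl (X^ (n * d)) (geomSeries d) ⟩
  geomSeries d ∎)
  where open ≋-Reasoning

-- Congruence modulo x^n and division of power series

infix 4 _≡_mod-X^_

_≡_mod-X^_ : Series → Series → ℕ → Set
f ≡ g mod-X^ n = ∀ k → k < n → f k ≡ g k

≋⇒≡-mod : ∀ {f g n} → f ≋ g → f ≡ g mod-X^ n
≋⇒≡-mod f≋g k _ = coeff f≋g k

≡-mod-trans : ∀ {f g h n} → f ≡ g mod-X^ n → g ≡ h mod-X^ n → f ≡ h mod-X^ n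
≡-mod-trans f≡g g≡h k k<n = trans (f≡g k k<n) (g≡h k k<n)

≡-mod-weaken : ∀ {f g m n} → m ≤ n → f ≡ g mod-X^ n → f ≡ g mod-X^ m
≡-mod-weaken m≤n f≡g k k<m = f≡g k (ℕP.<-≤-trans k<m m≤n)

≡-mod-+ : ∀ {f f′ g g′ n} → f ≡ f′ mod-X^ n → g ≡ g′ mod-X^ n → (f +S g) ≡ (f′ +S g′) mod-X^ n
≡-mod-+ f≡f′ g≡g′ k k<n = cong₂ ℤ._+_ (f≡f′ k k<n) (g≡g′ k k<n)

≡-mod-neg : ∀ {f g n} → f ≡ g mod-X^ n → (-S f) ≡ (-S g) mod-X^ n
≡-mod-neg f≡g k k<n = cong ℤ.-_ (f≡g k k<n)

X^-≡0-mod : ∀ e → X^ e ≡ 0S mod-X^ e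
X^-≡0-mod e k k<e = X^-coeff-≢ (ℕP.>⇒≢ k<e)

*-≡0-mod : ∀ {f g m n} → f ≡ 0S mod-X^ m → g ≡ 0S mod-X^ n → (f *S g) ≡ 0S mod-X^ (m + n)
*-≡0-mod {f} {g} {m} {n} f≡0 g≡0 k k<m+n = sumℤ-zero (suc k) term≡0
  where
  term≡0 : ∀ i → i < suc k → f i ℤ.* g (k ∸ i) ≡ + 0
  term≡0 i i≤k with i ℕ.<? m
  ... | yes i<m = cong (ℤ._* g (k ∸ i)) (f≡0 i i<m)
  ... | no  i≮m = trans (cong (f i ℤ.*_) (g≡0 (k ∸ i) k∸i<n)) (ℤP.*-zeroʳ (f i))
    where
    k∸i<n : k ∸ i < n
    k∸i<n = subst (k ∸ i <_) (ℕP.m+n∸m≡n i n)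
                  (ℕP.∸-monoˡ-< (ℕP.<-≤-trans k<m+n (ℕP.+-monoˡ-≤ n (ℕP.≮⇒≥ i≮m))) (ℕP.≤-pred i≤k))

*-≡0-modˡ : ∀ {f m} g → f ≡ 0S mod-X^ m → (f *S g) ≡ 0S mod-X^ m
*-≡0-modˡ {m = m} g f≡0 = subst (_ ≡ 0S mod-X^_) (ℕP.+-identityʳ m) (*-≡0-mod {g = g} f≡0 (λ _ ()))

nth-++-< : ∀ (xs : List ℤ) y {k} → k < length xs → nth (xs ++ y ∷ []) k ≡ nth xs k
nth-++-< (x ∷ xs) y {zero}  _         = refl
nth-++-< (x ∷ xs) y {suc k} (s≤s k<n) = nth-++-< xs y k<n

nth-++-length : ∀ (xs : List ℤ) y → nth (xs ++ y ∷ []) (length xs) ≡ y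
nth-++-length []       y = refl
nth-++-length (x ∷ xs) y = nth-++-length xs y

divCoeffs-length : ∀ f g n → length (divCoeffs f g n) ≡ n
divCoeffs-length f g zero    = refl
divCoeffs-length f g (suc n) =
  trans (length-++ (divCoeffs f g n)) (trans (ℕP.+-comm _ 1) (cong suc (divCoeffs-length f g n)))

divCoeffs-nth : ∀ f g n {k} → k < n → nth (divCoeffs f g n) k ≡ divS f g k
divCoeffs-nth f g (suc n) (s≤s k≤n) with ℕP.m≤n⇒m<n∨m≡n k≤n
... | inj₁ k<n  = trans (nth-++-< (divCoeffs f g n) _ (subst (_ <_) (sym (divCoeffs-length f g n)) k<n))
                        (divCoeffs-nth f g n k<n)
... | inj₂ refl = refl

divS-recurrence : ∀ f g k →
  divS f g k ≡ g 0 ℤ.* (f k ℤ.- sumℤ k (λ j → g (suc j) ℤ.* divS f g (k ∸ suc j)))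
divS-recurrence f g k =
  trans (subst (λ m → nth (divCoeffs f g k ++ last ∷ []) m ≡ last) (divCoeffs-length f g k)
               (nth-++-length (divCoeffs f g k) last))
        (cong (λ s → g 0 ℤ.* (f k ℤ.- s))
              (sumℤ-cong k (λ j j<k → cong (g (suc j) ℤ.*_)
                 (divCoeffs-nth f g k (ℕP.∸-monoʳ-< (s≤s z≤n) j<k)))))
  where
  last : ℤ
  last = g 0 ℤ.* (f k ℤ.- sumℤ k (λ j → g (suc j) ℤ.* nth (divCoeffs f g k) (k ∸ suc j)))

divS-unique : ∀ {f g h K} → g 0 ℤ.* g 0 ≡ + 1 → (g *S h) ≡ f mod-X^ K → divS f g ≡ h mod-X^ K
divS-unique {f} {g} {h} {K} g₀²≡1 gh≡f k = go k (ℕI.<-wellFounded k)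
  where
  rest : ℕ → ℤ
  rest k = sumℤ k (λ j → g (suc j) ℤ.* h (k ∸ suc j))
  cancel : ∀ a b c → a ℤ.* (a ℤ.* b ℤ.+ c ℤ.- c) ≡ a ℤ.* a ℤ.* b
  cancel = ℤ-Ring.solve-∀
  go : ∀ k → Acc _<_ k → k < K → divS f g k ≡ h k
  go k (acc smaller) k<K = begin
    divS f g k
      ≡⟨ divS-recurrence f g k ⟩
    g 0 ℤ.* (f k ℤ.- sumℤ k (λ j → g (suc j) ℤ.* divS f g (k ∸ suc j)))
      ≡⟨ cong (λ s → g 0 ℤ.* (f k ℤ.- s)) (sumℤ-cong k (λ j j<k → cong (g (suc j) ℤ.*_)
           (go (k ∸ suc j) (smaller (k∸1+j<k j<k)) (ℕP.<-trans (k∸1+j<k j<k) k<K)))) ⟩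
    g 0 ℤ.* (f k ℤ.- rest k)
      ≡⟨ cong (λ c → g 0 ℤ.* (c ℤ.- rest k)) (sym (gh≡f k k<K)) ⟩
    g 0 ℤ.* ((g *S h) k ℤ.- rest k)
      ≡⟨ cong (λ c → g 0 ℤ.* (c ℤ.- rest k)) (sumℤ-unconsˡ k (λ i → g i ℤ.* h (k ∸ i))) ⟩
    g 0 ℤ.* (g 0 ℤ.* h k ℤ.+ rest k ℤ.- rest k)
      ≡⟨ cancel (g 0) (h k) (rest k) ⟩
    g 0 ℤ.* g 0 ℤ.* h k
      ≡⟨ trans (cong (ℤ._* h k) g₀²≡1) (ℤP.*-identityˡ (h k)) ⟩
    h k ∎
    where
    open ≡-Reasoning
    k∸1+j<k : ∀ {j} → j < k → k ∸ suc j < k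
    k∸1+j<k j<k = ℕP.∸-monoʳ-< (s≤s z≤n) j<k

-- Cyclotomic polynomials of primes and of products of two primes

prime⇒>1 : ∀ {p} → Prime p → 1 < p
prime⇒>1 {p} pp = ℕ.nonTrivial⇒n>1 p ⦃ prime⇒nonTrivial pp ⦄

divisor-of-prime-product : ∀ {p q d} → Prime p → Prime q → d ∣ p * q →
                           d ≡ 1 ⊎ d ≡ p ⊎ d ≡ q ⊎ d ≡ p * q
divisor-of-prime-product {p} {q} {d} pp pq d∣pq with p ∣? d
... | yes (divides e refl) with prime⇒irreducible pq e∣q
  where
  e∣q : e ∣ q
  e∣q = *-cancelʳ-∣ p ⦃ prime⇒nonZero pp ⦄ (subst (e * p ∣_) (ℕP.*-comm p q) d∣pq)
...   | inj₁ refl = inj₂ (inj₁ (ℕP.*-identityˡ p))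
...   | inj₂ refl = inj₂ (inj₂ (inj₂ (ℕP.*-comm q p)))
divisor-of-prime-product {p} {q} {d} pp pq d∣pq | no p∤d with prime⇒irreducible pq (coprime-divisor d⊥p d∣pq)
  where
  d⊥p : Coprime d p
  d⊥p (c∣d , c∣p) with prime⇒irreducible pp c∣p
  ... | inj₁ c≡1  = c≡1
  ... | inj₂ refl = ⊥-elim (p∤d c∣d)
...   | inj₁ d≡1 = inj₁ d≡1
...   | inj₂ d≡q = inj₂ (inj₂ (inj₁ d≡q))

cycTable-stable : ∀ {n d} → 0 < d → d ≤ n → cycTable n d ≡ Φ d
cycTable-stable {zero}  (s≤s z≤n) ()
cycTable-stable {suc n} {d} 0<d d≤1+n with d ℕ.≟ suc n
... | yes refl = refl
... | no  d≢1+n rewrite ≢⇒≡ᵇ-false d≢1+n = cycTable-stable 0<d (ℕP.≤-pred (ℕP.≤∧≢⇒< d≤1+n d≢1+n))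

divisorFactor : ℕ → ℕ → Series
divisorFactor m i = if does (suc i ∣? suc m) then cycTable m (suc i) else 1S

Φ-suc : ∀ m → Φ (suc m) ≡ divS (X^ (suc m) -S 1S) (prodS m (divisorFactor m))
Φ-suc m rewrite ≡ᵇ-refl m = refl

divisorFactor-∤ : ∀ {m i} → ¬ (suc i ∣ suc m) → divisorFactor m i ≋ 1S
divisorFactor-∤ {m} {i} ∤ = coeffwise (λ k →
  cong (λ b → (if b then cycTable m (suc i) else 1S) k) (dec-false (suc i ∣? suc m) ∤))

divisorFactor-∣ : ∀ {m i} → suc i ∣ suc m → i < m → divisorFactor m i ≋ Φ (suc i)
divisorFactor-∣ {m} {i} ∣ i<m = coeffwise (λ k →
  trans (cong (λ b → (if b then cycTable m (suc i) else 1S) k) (dec-true (suc i ∣? suc m) ∣))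
        (cong (λ f → f k) (cycTable-stable (s≤s z≤n) i<m)))

prodS-skip : ∀ {j k} F → j ≤ k → (∀ i → j ≤ i → i < k → F i ≋ 1S) → prodS k F ≋ prodS j F
prodS-skip {j} {zero}  F z≤n   _      = ≋-refl
prodS-skip {j} {suc k} F j≤1+k F≋1 with ℕP.m≤n⇒m<n∨m≡n j≤1+k
... | inj₂ refl = ≋-refl
... | inj₁ (s≤s j≤k) = begin
  prodS k F *S F k ≈⟨ *-cong (prodS-skip {j} {k} F j≤k (λ i j≤i i<k → F≋1 i j≤i (ℕP.m<n⇒m<1+n i<k)))
                             (F≋1 k j≤k ℕP.≤-refl) ⟩
  prodS j F *S 1S  ≈⟨ *-identityʳ (prodS j F) ⟩
  prodS j F ∎
  where open ≋-Reasoning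

unit-square : ∀ {z} → z ≡ ℤ.- + 1 → z ℤ.* z ≡ + 1
unit-square refl = refl

divS-exact : ∀ {f g h} → g 0 ℤ.* g 0 ≡ + 1 → (g *S h) ≋ f → divS f g ≋ h
divS-exact {f} {g} {h} unit gh≋f = coeffwise (λ k → divS-unique {f} {g} {h} unit (λ j _ → coeff gh≋f j) k (ℕP.n<1+n k))

1-X-geomSum : ∀ n → ((1S -S X) *S geomSum n 1) ≋ (1S -S X^ n)
1-X-geomSum n = ≋-trans (geomSum-telescope n 1) (+-cong (≋-refl {1S}) (-‿cong (X^-cong (ℕP.*-identityʳ n))))

X-1-geomSum : ∀ n → ((X -S 1S) *S geomSum n 1) ≋ (X^ n -S 1S)
X-1-geomSum n = begin
  (X -S 1S) *S geomSum n 1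
    ≈⟨ solve 2 (λ x g → (x :- con (+ 1)) :* g := :- ((con (+ 1) :- x) :* g)) ≋-refl X (geomSum n 1) ⟩
  -S ((1S -S X) *S geomSum n 1)
    ≈⟨ -‿cong (1-X-geomSum n) ⟩
  -S (1S -S X^ n)
    ≈⟨ solve 1 (λ y → :- (con (+ 1) :- y) := y :- con (+ 1)) ≋-refl (X^ n) ⟩
  X^ n -S 1S ∎
  where open ≋-Reasoning

Φ-1 : Φ 1 ≋ (X -S 1S)
Φ-1 = divS-exact refl (*-identityˡ (X -S 1S))

-- 1 and p are the only divisors of p, so the product of the proper ones is Φ₁ = x - 1
Φ-prime : ∀ {p} → Prime p → Φ p ≋ geomSum p 1
Φ-prime {p} pp with prime⇒>1 pp
... | s≤s {n = m} 1≤m = ≋-trans (coeffwise (λ k → cong (λ f → f k) (Φ-suc m)))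
                               (divS-exact (unit-square (coeff proper≋X-1 0))
                                           (≋-trans (*-cong proper≋X-1 (≋-refl {geomSum p 1})) (X-1-geomSum p)))
  where
  open ≋-Reasoning
  proper≋X-1 : prodS m (divisorFactor m) ≋ (X -S 1S)
  proper≋X-1 = begin
    prodS m (divisorFactor m)
      ≈⟨ prodS-skip (divisorFactor m) 1≤m (λ i 1≤i i<m → divisorFactor-∤ (λ i+1∣p →
           [ (λ i+1≡1 → ℕP.<⇒≢ 1≤i (ℕP.suc-injective (sym i+1≡1)))
           , (λ i+1≡p → ℕP.<⇒≢ i<m (ℕP.suc-injective i+1≡p)) ] (prime⇒irreducible pp i+1∣p))) ⟩
    1S *S divisorFactor m 0
      ≈⟨ *-identityˡ (divisorFactor m 0) ⟩
    divisorFactor m 0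
      ≈⟨ divisorFactor-∣ (divides p (sym (ℕP.*-identityʳ p))) 1≤m ⟩
    Φ 1
      ≈⟨ Φ-1 ⟩
    X -S 1S ∎

semiprimeSeries : ℕ → ℕ → Series
semiprimeSeries p q = (1S -S X) *S (geomSeries p *S geomSeries q)

Φ-semiprime : ∀ {p q} → Prime p → Prime q → p < q → Φ (p * q) ≡ semiprimeSeries p q mod-X^ (p * q)
Φ-semiprime {p} {q} pp pq p<q with prime⇒>1 pp | prime⇒>1 pq
... | s≤s {n = a} 1≤a | s≤s {n = b} _ = λ k k<pq →
  trans (cong (λ f → f k) (Φ-suc m)) (divS-unique {h = semiprimeSeries p q} unit agree k k<pq)
  where
  -- p * q = suc m definitionally
  m : ℕ
  m = b + a * q
  a<b : a < b
  a<b = ℕP.≤-pred p<q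
  b<m : b < m
  b<m = subst (_≤ m) (ℕP.+-comm b 1) (ℕP.+-monoʳ-≤ b (ℕP.≤-trans 1≤a (ℕP.m≤m*n a q)))

  nonfactor : ∀ {i} → i ≢ 0 → i ≢ a → i ≢ b → i < m → divisorFactor m i ≋ 1S
  nonfactor {i} i≢0 i≢a i≢b i<m = divisorFactor-∤ λ i+1∣pq →
    case (divisor-of-prime-product pp pq i+1∣pq)
    where
    case : suc i ≡ 1 ⊎ suc i ≡ p ⊎ suc i ≡ q ⊎ suc i ≡ p * q → _
    case (inj₁ e)               = i≢0 (ℕP.suc-injective e)
    case (inj₂ (inj₁ e))        = i≢a (ℕP.suc-injective e)
    case (inj₂ (inj₂ (inj₁ e))) = i≢b (ℕP.suc-injective e)
    case (inj₂ (inj₂ (inj₂ e))) = ℕP.<⇒≢ i<m (ℕP.suc-injective e)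

  G : Series
  G = (X -S 1S) *S (geomSum p 1 *S geomSum q 1)

  proper≋G : prodS m (divisorFactor m) ≋ G
  proper≋G = begin
    prodS m (divisorFactor m)
      ≈⟨ prodS-skip (divisorFactor m) b<m (λ i b<i i<m → nonfactor
           (ℕP.>⇒≢ (ℕP.<-≤-trans (s≤s z≤n) b<i)) (ℕP.>⇒≢ (ℕP.<-trans a<b b<i)) (ℕP.>⇒≢ b<i) i<m) ⟩
    prodS b (divisorFactor m) *S divisorFactor m b
      ≈⟨ *-cong (prodS-skip (divisorFactor m) a<b (λ i a<i i<b → nonfactor
           (ℕP.>⇒≢ (ℕP.<-≤-trans (s≤s z≤n) a<i)) (ℕP.>⇒≢ a<i) (ℕP.<⇒≢ i<b) (ℕP.<-trans i<b b<m)))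
         (divisorFactor-∣ (divides p refl) b<m) ⟩
    (prodS a (divisorFactor m) *S divisorFactor m a) *S Φ q
      ≈⟨ *-cong (*-cong (prodS-skip (divisorFactor m) 1≤a (λ i 1≤i i<a → nonfactor
           (ℕP.>⇒≢ 1≤i) (ℕP.<⇒≢ i<a) (ℕP.<⇒≢ (ℕP.<-trans i<a a<b)) (ℕP.<-trans i<a (ℕP.<-trans a<b b<m))))
         (divisorFactor-∣ (divides q (ℕP.*-comm p q)) (ℕP.<-trans a<b b<m))) (Φ-prime pq) ⟩
    ((1S *S divisorFactor m 0) *S Φ p) *S geomSum q 1
      ≈⟨ *-cong (*-cong (≋-trans (*-identityˡ (divisorFactor m 0))
           (≋-trans (divisorFactor-∣ (divides (p * q) (sym (ℕP.*-identityʳ (p * q)))) (ℕP.<-trans (ℕP.<-trans 1≤a a<b) b<m)) Φ-1))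
           (Φ-prime pp)) (≋-refl {geomSum q 1}) ⟩
    ((X -S 1S) *S geomSum p 1) *S geomSum q 1
      ≈⟨ *-assoc (X -S 1S) (geomSum p 1) (geomSum q 1) ⟩
    G ∎
    where open ≋-Reasoning

  G-inverse : (G *S semiprimeSeries p q) ≋ (-S 1S)
  G-inverse = begin
    G *S semiprimeSeries p q
      ≈⟨ solve 5 (λ x gp gq sp sq →
              ((x :- con (+ 1)) :* (gp :* gq)) :* ((con (+ 1) :- x) :* (sp :* sq))
           := :- ((((con (+ 1) :- x) :* gp) :* sp) :* (((con (+ 1) :- x) :* gq) :* sq)))
           ≋-refl X (geomSum p 1) (geomSum q 1) (geomSeries p) (geomSeries q) ⟩
    -S ((((1S -S X) *S geomSum p 1) *S geomSeries p) *S (((1S -S X) *S geomSum q 1) *S geomSeries q))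
      ≈⟨ -‿cong (*-cong (≋-trans (*-cong (1-X-geomSum p) (≋-refl {geomSeries p})) (geomSeries-inverse (s≤s z≤n)))
                        (≋-trans (*-cong (1-X-geomSum q) (≋-refl {geomSeries q})) (geomSeries-inverse (s≤s z≤n)))) ⟩
    -S (1S *S 1S)
      ≈⟨ -‿cong (*-identityˡ 1S) ⟩
    -S 1S ∎
    where open ≋-Reasoning

  unit : prodS m (divisorFactor m) 0 ℤ.* prodS m (divisorFactor m) 0 ≡ + 1
  unit = unit-square (begin
    prodS m (divisorFactor m) 0
      ≡⟨ trans (coeff proper≋G 0) (*S-coeff-0 (X -S 1S) (geomSum p 1 *S geomSum q 1)) ⟩
    (X -S 1S) 0 ℤ.* (geomSum p 1 *S geomSum q 1) 0
      ≡⟨ cong (ℤ._*_ (ℤ.- + 1)) (trans (*S-coeff-0 (geomSum p 1) (geomSum q 1))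
                                      (cong₂ ℤ._*_ (geomSum-coeff-0 a) (geomSum-coeff-0 b))) ⟩
    ℤ.- + 1 ∎)
    where open ≡-Reasoning

  agree : (prodS m (divisorFactor m) *S semiprimeSeries p q) ≡ X^ (p * q) -S 1S mod-X^ (p * q)
  agree k k<pq = trans (coeff (≋-trans (*-cong proper≋G (≋-refl {semiprimeSeries p q})) G-inverse) k)
                       (trans (sym (ℤP.+-identityˡ (ℤ.- 1S k)))
                              (cong (λ c → c ℤ.+ ℤ.- 1S k) (sym (X^-coeff-≢ (ℕP.>⇒≢ k<pq)))))

semiprimeSeries-≡1-mod : ∀ {p} q₂ → 0 < p → semiprimeSeries p (suc (q₂ * p)) ≋
  (geomSeries p -S (X *S (geomSum q₂ p *S geomSeries (suc (q₂ * p)))))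
semiprimeSeries-≡1-mod {p} q₂ 0<p = ≋-sym (begin
  P -S (X *S (geomSum q₂ p *S Q))
    ≈⟨ +-cong (≋-sym (≋-trans (*-cong (≋-refl {P}) (geomSeries-inverse (s≤s z≤n))) (*-identityʳ P)))
              (-‿cong (*-cong (≋-refl {X}) (*-cong (geomSum-as-series q₂ 0<p) (≋-refl {Q})))) ⟩
  (P *S ((1S -S X^ q) *S Q)) -S (X *S (((1S -S Y) *S P) *S Q))
    ≈⟨ +-cong (*-cong (≋-refl {P}) (*-cong (+-cong (≋-refl {1S}) (-‿cong (≋-sym (X^-+ 1 (q₂ * p))))) (≋-refl {Q})))
              (≋-refl { -S (X *S (((1S -S Y) *S P) *S Q))}) ⟩
  (P *S ((1S -S (X *S Y)) *S Q)) -S (X *S (((1S -S Y) *S P) *S Q))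
    ≈⟨ solve 4 (λ P Q x y → (P :* ((con (+ 1) :- x :* y) :* Q)) :- (x :* (((con (+ 1) :- y) :* P) :* Q))
                          := (con (+ 1) :- x) :* (P :* Q)) ≋-refl P Q X Y ⟩
  semiprimeSeries p q ∎)
  where
  open ≋-Reasoning
  q : ℕ
  q = suc (q₂ * p)
  P Q Y : Series
  P = geomSeries p
  Q = geomSeries q
  Y = X^ (q₂ * p)

Degree≤ : ℕ → Series → Set
Degree≤ d f = ∀ k → d < k → f k ≡ + 0

Degree≤-≋ : ∀ {d f g} → f ≋ g → Degree≤ d f → Degree≤ d g
Degree≤-≋ f≋g f≤d k d<k = trans (sym (coeff f≋g k)) (f≤d k d<k)

Degree≤-weaken : ∀ {d e f} → d ≤ e → Degree≤ d f → Degree≤ e f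
Degree≤-weaken d≤e f≤d k e<k = f≤d k (ℕP.≤-<-trans d≤e e<k)

Degree≤-+ : ∀ {d f g} → Degree≤ d f → Degree≤ d g → Degree≤ d (f +S g)
Degree≤-+ f≤d g≤d k d<k = cong₂ ℤ._+_ (f≤d k d<k) (g≤d k d<k)

Degree≤-neg : ∀ {d f} → Degree≤ d f → Degree≤ d (-S f)
Degree≤-neg f≤d k d<k = cong ℤ.-_ (f≤d k d<k)

Degree≤-X^ : ∀ e → Degree≤ e (X^ e)
Degree≤-X^ e k e<k = X^-coeff-≢ (ℕP.<⇒≢ e<k)

Degree≤-0S : ∀ d → Degree≤ d 0S
Degree≤-0S d _ _ = refl

Degree≤-* : ∀ {m n f g} → Degree≤ m f → Degree≤ n g → Degree≤ (m + n) (f *S g)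
Degree≤-* {m} {n} {f} {g} f≤m g≤n k m+n<k = sumℤ-zero (suc k) term≡0
  where
  term≡0 : ∀ i → i < suc k → f i ℤ.* g (k ∸ i) ≡ + 0
  term≡0 i i≤k with m ℕ.<? i
  ... | yes m<i = cong (ℤ._* g (k ∸ i)) (f≤m i m<i)
  ... | no  m≮i = trans (cong (f i ℤ.*_) (g≤n (k ∸ i) n<k∸i)) (ℤP.*-zeroʳ (f i))
    where
    n<k∸i : n < k ∸ i
    n<k∸i = subst (_< k ∸ i) (ℕP.m+n∸m≡n i n)
                  (ℕP.∸-monoˡ-< (ℕP.≤-<-trans (ℕP.+-monoˡ-≤ n (ℕP.≮⇒≥ m≮i)) m+n<k) (ℕP.m≤m+n i n))

Degree≤-sumS : ∀ {d} n {F : ℕ → Series} → (∀ i → i < n → Degree≤ d (F i)) → Degree≤ d (sumS n F)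
Degree≤-sumS zero    _    _ _ = refl
Degree≤-sumS (suc n) F≤d = Degree≤-+ (Degree≤-sumS n (λ i i<n → F≤d i (ℕP.m<n⇒m<1+n i<n))) (F≤d n ℕP.≤-refl)

T-coeff-< : ∀ {n k} f → k < n → T (+ n) f k ≡ f k
T-coeff-< {n} {k} f k<n rewrite dec-true (+ k ℤ.<? + n) (ℤ.+<+ k<n) = refl

T-coeff-≥ : ∀ {n k} f → n ≤ k → T (+ n) f k ≡ + 0
T-coeff-≥ {n} {k} f n≤k rewrite dec-false (+ k ℤ.<? + n) (λ k<n → ℕP.<⇒≱ (ℤP.drop‿+<+ k<n) n≤k) = refl

T-unique : ∀ {f g d} → f ≡ g mod-X^ suc d → Degree≤ d g → T (+ (d + 1)) f ≈S g
T-unique {f} {g} {d} f≡g g≤d k with k ℕ.≤? d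
... | yes k≤d = trans (T-coeff-< f k<d+1) (f≡g k (s≤s k≤d))
  where
  k<d+1 : k < d + 1
  k<d+1 = subst (k <_) (ℕP.+-comm 1 d) (s≤s k≤d)
... | no  k≰d = trans (T-coeff-≥ f d+1≤k) (sym (g≤d k (ℕP.≰⇒> k≰d)))
  where
  d+1≤k : d + 1 ≤ k
  d+1≤k = subst (_≤ k) (ℕP.+-comm 1 d) (ℕP.≰⇒> k≰d)

T-X-large : ∀ {s} → + 1 ℤ.< s → T s X ≋ X
T-X-large {s} 1<s = coeffwise coeff-k
  where
  coeff-k : ∀ k → T s X k ≡ X k
  coeff-k k with + k ℤ.<? s
  ... | yes _ = refl
  ... | no k≮s with k ℕ.≟ 1
  ...   | yes refl = ⊥-elim (k≮s 1<s)
  ...   | no  k≢1  = sym (X^-coeff-≢ (k≢1 ∘ sym))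

T-X-small : ∀ {s} → s ℤ.≤ + 1 → T s X ≋ 0S
T-X-small {s} s≤1 = coeffwise coeff-k
  where
  coeff-k : ∀ k → T s X k ≡ + 0
  coeff-k k with + k ℤ.<? s
  ... | no _ = refl
  ... | yes k<s with k ℕ.≟ 1
  ...   | yes refl = ⊥-elim (ℤP.≤⇒≯ s≤1 k<s)
  ...   | no  k≢1  = X^-coeff-≢ (k≢1 ∘ sym)

-- The expansion of Φ_pq up to degree u

Bsize-< : ∀ {i₁ q₂ i₂ a} → a < i₁ → Bsize i₁ q₂ i₂ a ≡ q₂
Bsize-< {i₁} {q₂} {i₂} {a} a<i₁ rewrite dec-true (a ℕ.<? i₁) a<i₁ = refl

Bsize-≡ : ∀ i₁ q₂ i₂ → Bsize i₁ q₂ i₂ i₁ ≡ i₂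
Bsize-≡ i₁ q₂ i₂ rewrite dec-false (i₁ ℕ.<? i₁) (ℕP.<-irrefl refl) = refl

-- rhs is the right-hand side of lemma4 for p₁ = p, p₂ = q, and h is Φ_pq modulo x^{pq}.
-- In closed the inner sums of rhs are evaluated as geometric sums; tail = h - closed
-- consists of terms of degree > u = M p + i₃.
module Expansion (p q₂ i₁ i₂ i₃ : ℕ) (i₁<p : i₁ < p) (i₂<q₂ : i₂ < q₂) (i₃<p : i₃ < p) where

  q M u e : ℕ
  q = suc (q₂ * p)
  M = i₁ * q₂ + i₂
  u = i₁ * (q₂ * p) + i₂ * p + i₃
  e = i₁ * q + i₂ * p

  r : Series
  r = geomSum q₂ p

  W : ℕ → Series
  W a = (-S X) +S X^ (p ∸ a)

  summand : ℕ → Series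
  summand a = X^ (a * q) *S sumS (Bsize i₁ q₂ i₂ a) (λ b → X^ (b * p) *S W a)

  E : Series
  E = X^ e *S T ((+ i₃ ℤ.- + i₁) ℤ.+ + 1) X

  rhs : Series
  rhs = (1S +S sumS (i₁ + 1) summand) -S E

  G₂ P Q : Series
  G₂ = geomSum i₂ p
  P  = geomSeries p
  Q  = geomSeries q

  h : Series
  h = P -S (X *S (r *S Q))

  closed : Series
  closed = (1S +S ((X^ p *S geomSum M p) -S (X *S ((geomSum i₁ q *S r) +S (X^ (i₁ * q) *S G₂))))) -S E

  tail : Series
  tail = ((X^ (suc M * p) *S P) -S (X *S (X^ (suc i₁ * q) *S (r *S Q))))
         +S (E -S (X *S (X^ (i₁ * q) *S (r -S G₂))))

  0<p : 0 < p
  0<p = ℕP.<-≤-trans (s≤s z≤n) i₃<p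

  u≡Mp+i₃ : u ≡ M * p + i₃
  u≡Mp+i₃ = regroup i₁ q₂ i₂ p i₃
    where
    regroup : ∀ i₁ q₂ i₂ p i₃ → i₁ * (q₂ * p) + i₂ * p + i₃ ≡ (i₁ * q₂ + i₂) * p + i₃
    regroup = ℕ-Ring.solve-∀

  e≡Mp+i₁ : e ≡ M * p + i₁
  e≡Mp+i₁ = regroup i₁ q₂ i₂ p
    where
    regroup : ∀ i₁ q₂ i₂ p → i₁ * suc (q₂ * p) + i₂ * p ≡ (i₁ * q₂ + i₂) * p + i₁
    regroup = ℕ-Ring.solve-∀

  exponent-≡ : ∀ {a} → a ≤ p → a * q + (p ∸ a) ≡ p + a * q₂ * p
  exponent-≡ {a} a≤p = begin
    a * q + (p ∸ a)             ≡⟨ regroup a q₂ p (p ∸ a) ⟩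
    (a + (p ∸ a)) + a * q₂ * p  ≡⟨ cong (_+ a * q₂ * p) (ℕP.m+[n∸m]≡n a≤p) ⟩
    p + a * q₂ * p              ∎
    where
    open ≡-Reasoning
    regroup : ∀ a q₂ p t → a * suc (q₂ * p) + t ≡ (a + t) + a * q₂ * p
    regroup = ℕ-Ring.solve-∀

  u<[1+M]p : u < suc M * p
  u<[1+M]p = begin-strict
    u         ≡⟨ u≡Mp+i₃ ⟩
    M * p + i₃ <⟨ ℕP.+-monoʳ-< (M * p) i₃<p ⟩
    M * p + p ≡⟨ ℕP.+-comm (M * p) p ⟩
    suc M * p ∎
    where open ℕP.≤-Reasoning

  [1+M]p≤[1+i₁]q : suc M * p ≤ suc i₁ * q
  [1+M]p≤[1+i₁]q = begin
    suc M * p              ≤⟨ ℕP.*-monoˡ-≤ p 1+M≤[1+i₁]q₂ ⟩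
    suc i₁ * q₂ * p        ≡⟨ ℕP.*-assoc (suc i₁) q₂ p ⟩
    suc i₁ * (q₂ * p)      ≤⟨ ℕP.*-monoʳ-≤ (suc i₁) (ℕP.n≤1+n (q₂ * p)) ⟩
    suc i₁ * q ∎
    where
    open ℕP.≤-Reasoning
    1+M≤[1+i₁]q₂ : suc M ≤ suc i₁ * q₂
    1+M≤[1+i₁]q₂ = begin
      suc M            ≡⟨ ℕP.+-suc (i₁ * q₂) i₂ ⟨
      i₁ * q₂ + suc i₂ ≤⟨ ℕP.+-monoʳ-≤ (i₁ * q₂) i₂<q₂ ⟩
      i₁ * q₂ + q₂     ≡⟨ ℕP.+-comm (i₁ * q₂) q₂ ⟩
      suc i₁ * q₂      ∎

  u<pq : u < p * q
  u<pq = begin-strict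
    u          <⟨ u<[1+M]p ⟩
    suc M * p  ≤⟨ [1+M]p≤[1+i₁]q ⟩
    suc i₁ * q ≤⟨ ℕP.*-monoˡ-≤ q i₁<p ⟩
    p * q      ∎
    where open ℕP.≤-Reasoning

  u≤e+p : u ≤ e + p
  u≤e+p = begin
    u              ≡⟨ u≡Mp+i₃ ⟩
    M * p + i₃     ≤⟨ ℕP.+-monoʳ-≤ (M * p) (ℕP.≤-trans (ℕP.n≤1+n i₃) i₃<p) ⟩
    M * p + p      ≤⟨ ℕP.+-monoˡ-≤ p (ℕP.m≤m+n (M * p) i₁) ⟩
    M * p + i₁ + p ≡⟨ cong (_+ p) e≡Mp+i₁ ⟨
    e + p          ∎
    where open ℕP.≤-Reasoning

  i₃≤i₁⇒u<e+1 : i₃ ≤ i₁ → suc u ≤ e + 1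
  i₃≤i₁⇒u<e+1 i₃≤i₁ = begin
    suc u            ≡⟨ cong suc u≡Mp+i₃ ⟩
    suc (M * p + i₃) ≤⟨ s≤s (ℕP.+-monoʳ-≤ (M * p) i₃≤i₁) ⟩
    suc (M * p + i₁) ≡⟨ cong suc e≡Mp+i₁ ⟨
    suc e            ≡⟨ ℕP.+-comm 1 e ⟩
    e + 1            ∎
    where open ℕP.≤-Reasoning

  i₁<i₃⇒e+1≤u : i₁ < i₃ → e + 1 ≤ u
  i₁<i₃⇒e+1≤u i₁<i₃ = begin
    e + 1            ≡⟨ cong (_+ 1) e≡Mp+i₁ ⟩
    M * p + i₁ + 1   ≡⟨ ℕP.+-assoc (M * p) i₁ 1 ⟩
    M * p + (i₁ + 1) ≤⟨ ℕP.+-monoʳ-≤ (M * p) (subst (_≤ i₃) (ℕP.+-comm 1 i₁) i₁<i₃) ⟩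
    M * p + i₃       ≡⟨ u≡Mp+i₃ ⟨
    u                ∎
    where open ℕP.≤-Reasoning

  summand-exponent≤u : ∀ {a b} → a ≤ i₁ → b < Bsize i₁ q₂ i₂ a → a * q + (b * p + (p ∸ a)) ≤ u
  summand-exponent≤u {a} {b} a≤i₁ b<B = begin
    a * q + (b * p + (p ∸ a))  ≡⟨ swap (a * q) (b * p) (p ∸ a) ⟩
    b * p + (a * q + (p ∸ a))  ≡⟨ cong (_+_ (b * p)) (exponent-≡ (ℕP.≤-trans a≤i₁ (ℕP.<⇒≤ i₁<p))) ⟩
    b * p + (p + a * q₂ * p)   ≡⟨ regroup a q₂ b p ⟩
    suc (a * q₂ + b) * p       ≤⟨ ℕP.*-monoˡ-≤ p 1+aq₂+b≤M ⟩
    M * p                      ≤⟨ ℕP.m≤m+n (M * p) i₃ ⟩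
    M * p + i₃                 ≡⟨ u≡Mp+i₃ ⟨
    u                          ∎
    where
    open ℕP.≤-Reasoning
    swap : ∀ x y t → x + (y + t) ≡ y + (x + t)
    swap = ℕ-Ring.solve-∀
    regroup : ∀ a q₂ b p → b * p + (p + a * q₂ * p) ≡ suc (a * q₂ + b) * p
    regroup = ℕ-Ring.solve-∀
    1+aq₂+b≤M : suc (a * q₂ + b) ≤ M
    1+aq₂+b≤M with ℕP.m≤n⇒m<n∨m≡n a≤i₁
    ... | inj₂ refl = ℕP.+-monoʳ-< (a * q₂) (subst (b <_) (Bsize-≡ i₁ q₂ i₂) b<B)
    ... | inj₁ a<i₁ = begin
      suc (a * q₂ + b) ≡⟨ ℕP.+-suc (a * q₂) b ⟨
      a * q₂ + suc b   ≤⟨ ℕP.+-monoʳ-≤ (a * q₂) (subst (b <_) (Bsize-< a<i₁) b<B) ⟩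
      a * q₂ + q₂      ≡⟨ ℕP.+-comm (a * q₂) q₂ ⟩
      suc a * q₂       ≤⟨ ℕP.*-monoˡ-≤ q₂ a<i₁ ⟩
      i₁ * q₂          ≤⟨ ℕP.m≤m+n (i₁ * q₂) i₂ ⟩
      M                ∎

  summand-closed : ∀ a B → a ≤ p → X^ (a * q) *S sumS B (λ b → X^ (b * p) *S W a) ≋
    ((X^ p *S (X^ (a * q₂ * p) *S geomSum B p)) -S (X *S (X^ (a * q) *S geomSum B p)))
  summand-closed a B a≤p = begin
    X^ (a * q) *S sumS B (λ b → X^ (b * p) *S W a)
      ≈⟨ *-cong (≋-refl {X^ (a * q)}) (sumS-*ʳ B (λ b → X^ (b * p)) (W a)) ⟩
    X^ (a * q) *S (geomSum B p *S W a)
      ≈⟨ solve 4 (λ z g x y → z :* (g :* (:- x :+ y)) := (z :* y) :* g :- x :* (z :* g))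
               ≋-refl (X^ (a * q)) (geomSum B p) X (X^ (p ∸ a)) ⟩
    ((X^ (a * q) *S X^ (p ∸ a)) *S geomSum B p) -S (X *S (X^ (a * q) *S geomSum B p))
      ≈⟨ +-cong (*-cong merge (≋-refl {geomSum B p})) (≋-refl { -S (X *S (X^ (a * q) *S geomSum B p))}) ⟩
    ((X^ p *S X^ (a * q₂ * p)) *S geomSum B p) -S (X *S (X^ (a * q) *S geomSum B p))
      ≈⟨ +-cong (*-assoc (X^ p) (X^ (a * q₂ * p)) (geomSum B p))
                (≋-refl { -S (X *S (X^ (a * q) *S geomSum B p))}) ⟩
    (X^ p *S (X^ (a * q₂ * p) *S geomSum B p)) -S (X *S (X^ (a * q) *S geomSum B p)) ∎
    where
    open ≋-Reasoning
    merge : (X^ (a * q) *S X^ (p ∸ a)) ≋ (X^ p *S X^ (a * q₂ * p))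
    merge = ≋-trans (X^-+ (a * q) (p ∸ a)) (≋-trans (X^-cong (exponent-≡ a≤p)) (≋-sym (X^-+ p (a * q₂ * p))))

  sum-closed : sumS (i₁ + 1) summand ≋
    ((X^ p *S geomSum M p) -S (X *S ((geomSum i₁ q *S r) +S (X^ (i₁ * q) *S G₂))))
  sum-closed = begin
    sumS (i₁ + 1) summand
      ≈⟨ coeffwise (λ k → cong (λ n → sumS n summand k) (ℕP.+-comm i₁ 1)) ⟩
    sumS i₁ summand +S summand i₁
      ≈⟨ +-cong full-blocks last-block ⟩
    ((X^ p *S geomSum (i₁ * q₂) p) -S (X *S (geomSum i₁ q *S r)))
      +S ((X^ p *S (X^ (i₁ * q₂ * p) *S G₂)) -S (X *S (X^ (i₁ * q) *S G₂)))
      ≈⟨ solve 7 (λ xp A B x G r C → ((xp :* A) :- (x :* (G :* r))) :+ ((xp :* B) :- (x :* C))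
                                   := (xp :* (A :+ B)) :- (x :* ((G :* r) :+ C)))
               ≋-refl (X^ p) (geomSum (i₁ * q₂) p) (X^ (i₁ * q₂ * p) *S G₂) X (geomSum i₁ q) r (X^ (i₁ * q) *S G₂) ⟩
    (X^ p *S (geomSum (i₁ * q₂) p +S (X^ (i₁ * q₂ * p) *S G₂))) -S (X *S ((geomSum i₁ q *S r) +S (X^ (i₁ * q) *S G₂)))
      ≈⟨ +-cong (*-cong (≋-refl {X^ p}) (≋-sym (geomSum-+ (i₁ * q₂) i₂ p)))
                (≋-refl { -S (X *S ((geomSum i₁ q *S r) +S (X^ (i₁ * q) *S G₂)))}) ⟩
    (X^ p *S geomSum M p) -S (X *S ((geomSum i₁ q *S r) +S (X^ (i₁ * q) *S G₂))) ∎
    where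
    open ≋-Reasoning
    last-block : summand i₁ ≋ ((X^ p *S (X^ (i₁ * q₂ * p) *S G₂)) -S (X *S (X^ (i₁ * q) *S G₂)))
    last-block = ≋-trans (coeffwise (λ k → cong (λ B → (X^ (i₁ * q) *S sumS B (λ b → X^ (b * p) *S W i₁)) k)
                                                 (Bsize-≡ i₁ q₂ i₂)))
                         (summand-closed i₁ i₂ (ℕP.<⇒≤ i₁<p))
    full-blocks : sumS i₁ summand ≋ ((X^ p *S geomSum (i₁ * q₂) p) -S (X *S (geomSum i₁ q *S r)))
    full-blocks = begin
      sumS i₁ summand
        ≈⟨ sumS-cong i₁ (λ a a<i₁ → ≋-trans
             (coeffwise (λ k → cong (λ B → (X^ (a * q) *S sumS B (λ b → X^ (b * p) *S W a)) k) (Bsize-< a<i₁)))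
             (summand-closed a q₂ (ℕP.<⇒≤ (ℕP.<-trans a<i₁ i₁<p)))) ⟩
      sumS i₁ (λ a → (X^ p *S (X^ (a * q₂ * p) *S r)) -S (X *S (X^ (a * q) *S r)))
        ≈⟨ sumS-- i₁ (λ a → X^ p *S (X^ (a * q₂ * p) *S r)) (λ a → X *S (X^ (a * q) *S r)) ⟩
      sumS i₁ (λ a → X^ p *S (X^ (a * q₂ * p) *S r)) -S sumS i₁ (λ a → X *S (X^ (a * q) *S r))
        ≈⟨ +-cong (sumS-*ˡ i₁ (X^ p) (λ a → X^ (a * q₂ * p) *S r))
                  (-‿cong (sumS-*ˡ i₁ X (λ a → X^ (a * q) *S r))) ⟩
      (X^ p *S sumS i₁ (λ a → X^ (a * q₂ * p) *S r)) -S (X *S sumS i₁ (λ a → X^ (a * q) *S r))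
        ≈⟨ +-cong (*-cong (≋-refl {X^ p}) (geomSum-blocks i₁ q₂ p))
                  (-‿cong (*-cong (≋-refl {X}) (sumS-*ʳ i₁ (λ a → X^ (a * q)) r))) ⟩
      (X^ p *S geomSum (i₁ * q₂) p) -S (X *S (geomSum i₁ q *S r)) ∎

  rhs≋closed : rhs ≋ closed
  rhs≋closed = +-cong (+-cong (≋-refl {1S}) sum-closed) (≋-refl { -S E})

  h≋closed+tail : h ≋ (closed +S tail)
  h≋closed+tail = begin
    P -S (X *S (r *S Q))
      ≈⟨ +-cong (≋-trans (geomSeries-split (suc M) 0<p) (+-cong (geomSum-unconsˡ M p) (≋-refl {X^ (suc M * p) *S P})))
                (-‿cong (*-cong (≋-refl {X}) (*-cong (≋-refl {r}) (geomSeries-split (suc i₁) (s≤s z≤n))))) ⟩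
    ((1S +S (X^ p *S geomSum M p)) +S (X^ (suc M * p) *S P))
      -S (X *S (r *S ((geomSum i₁ q +S X^ (i₁ * q)) +S (X^ (suc i₁ * q) *S Q))))
      ≈⟨ solve 12 (λ xp gM xN P x r G xi xQ Q G₂ E →
              ((con (+ 1) :+ xp :* gM) :+ xN :* P) :- x :* (r :* ((G :+ xi) :+ xQ :* Q))
           := ((con (+ 1) :+ (xp :* gM :- x :* (G :* r :+ xi :* G₂))) :- E)
              :+ ((xN :* P :- x :* (xQ :* (r :* Q))) :+ (E :- x :* (xi :* (r :- G₂)))))
           ≋-refl (X^ p) (geomSum M p) (X^ (suc M * p)) P X r (geomSum i₁ q) (X^ (i₁ * q)) (X^ (suc i₁ * q)) Q G₂ E ⟩
    closed +S tail ∎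
    where open ≋-Reasoning

  r-G₂ : (r -S G₂) ≋ (X^ (i₂ * p) *S (1S +S (X^ p *S geomSum (q₂ ∸ suc i₂) p)))
  r-G₂ = begin
    r -S G₂
      ≈⟨ +-cong (coeffwise (λ k → cong (λ n → geomSum n p k) q₂≡i₂+[1+c])) (≋-refl { -S G₂}) ⟩
    geomSum (i₂ + suc c) p -S G₂
      ≈⟨ +-cong (geomSum-+ i₂ (suc c) p) (≋-refl { -S G₂}) ⟩
    (G₂ +S (X^ (i₂ * p) *S geomSum (suc c) p)) -S G₂
      ≈⟨ solve 2 (λ g y → (g :+ y) :- g := y) ≋-refl G₂ (X^ (i₂ * p) *S geomSum (suc c) p) ⟩
    X^ (i₂ * p) *S geomSum (suc c) p
      ≈⟨ *-cong (≋-refl {X^ (i₂ * p)}) (geomSum-unconsˡ c p) ⟩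
    X^ (i₂ * p) *S (1S +S (X^ p *S geomSum c p)) ∎
    where
    open ≋-Reasoning
    c : ℕ
    c = q₂ ∸ suc i₂
    q₂≡i₂+[1+c] : q₂ ≡ i₂ + suc c
    q₂≡i₂+[1+c] = trans (sym (ℕP.m+[n∸m]≡n i₂<q₂)) (sym (ℕP.+-suc i₂ c))

  s : ℤ
  s = (+ i₃ ℤ.- + i₁) ℤ.+ + 1

  i₁<i₃⇒1<s : i₁ < i₃ → + 1 ℤ.< s
  i₁<i₃⇒1<s i₁<i₃ = subst (+ 1 ℤ.<_) (sym s≡) (ℤ.+<+ (ℕP.+-monoˡ-< 1 (ℕP.m<n⇒0<n∸m i₁<i₃)))
    where
    s≡ : s ≡ + (i₃ ∸ i₁ + 1)
    s≡ = cong (ℤ._+ + 1) (trans (ℤP.m-n≡m⊖n i₃ i₁) (ℤP.⊖-≥ (ℕP.<⇒≤ i₁<i₃)))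

  i₃≤i₁⇒s≤1 : i₃ ≤ i₁ → s ℤ.≤ + 1
  i₃≤i₁⇒s≤1 i₃≤i₁ = ℤP.+-monoˡ-≤ (+ 1) (ℤP.i≤j⇒i-j≤0 (ℤ.+≤+ i₃≤i₁))

  E≡X^e·X : (E -S (X^ e *S X)) ≡ 0S mod-X^ suc u
  E≡X^e·X with i₁ ℕ.<? i₃
  ... | yes i₁<i₃ = ≋⇒≡-mod (≋-trans (+-cong (*-cong (≋-refl {X^ e}) (T-X-large (i₁<i₃⇒1<s i₁<i₃)))
                                             (≋-refl { -S (X^ e *S X)}))
                                    (-‿inverseʳ (X^ e *S X)))
  ... | no  i₁≮i₃ = ≡-mod-+ (≋⇒≡-mod E≋0)
                            (≡-mod-neg (≡-mod-weaken (i₃≤i₁⇒u<e+1 (ℕP.≮⇒≥ i₁≮i₃))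
                                                     (*-≡0-mod (X^-≡0-mod e) (X^-≡0-mod 1))))
    where
    E≋0 : E ≋ 0S
    E≋0 = ≋-trans (*-cong (≋-refl {X^ e}) (T-X-small (i₃≤i₁⇒s≤1 (ℕP.≮⇒≥ i₁≮i₃)))) (zeroʳ (X^ e))

  tail≡0 : tail ≡ 0S mod-X^ suc u
  tail≡0 = ≡-mod-+ (≡-mod-+ beyond-P (≡-mod-neg beyond-Q)) (≡-mod-trans (≋⇒≡-mod split) (≡-mod-+ E≡X^e·X (≡-mod-neg beyond-r)))
    where
    beyond-P : (X^ (suc M * p) *S P) ≡ 0S mod-X^ suc u
    beyond-P = ≡-mod-weaken u<[1+M]p (*-≡0-modˡ P (X^-≡0-mod (suc M * p)))
    beyond-Q : (X *S (X^ (suc i₁ * q) *S (r *S Q))) ≡ 0S mod-X^ suc u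
    beyond-Q = ≡-mod-weaken (s≤s (ℕP.<⇒≤ (ℕP.<-≤-trans u<[1+M]p [1+M]p≤[1+i₁]q)))
                            (*-≡0-mod (X^-≡0-mod 1) (*-≡0-modˡ (r *S Q) (X^-≡0-mod (suc i₁ * q))))
    beyond-r : (X *S (X^ e *S (X^ p *S geomSum (q₂ ∸ suc i₂) p))) ≡ 0S mod-X^ suc u
    beyond-r = ≡-mod-weaken (s≤s u≤e+p)
      (*-≡0-mod (X^-≡0-mod 1) (*-≡0-mod (X^-≡0-mod e) (*-≡0-modˡ (geomSum (q₂ ∸ suc i₂) p) (X^-≡0-mod p))))
    split : (E -S (X *S (X^ (i₁ * q) *S (r -S G₂)))) ≋
            ((E -S (X^ e *S X)) -S (X *S (X^ e *S (X^ p *S geomSum (q₂ ∸ suc i₂) p))))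
    split = begin
      E -S (X *S (X^ (i₁ * q) *S (r -S G₂)))
        ≈⟨ +-cong (≋-refl {E}) (-‿cong (*-cong (≋-refl {X}) (*-cong (≋-refl {X^ (i₁ * q)}) r-G₂))) ⟩
      E -S (X *S (X^ (i₁ * q) *S (X^ (i₂ * p) *S (1S +S (X^ p *S geomSum (q₂ ∸ suc i₂) p)))))
        ≈⟨ solve 6 (λ E x a b y g → E :- x :* (a :* (b :* (con (+ 1) :+ y :* g)))
                                 := (E :- (a :* b) :* x) :- x :* ((a :* b) :* (y :* g)))
                 ≋-refl E X (X^ (i₁ * q)) (X^ (i₂ * p)) (X^ p) (geomSum (q₂ ∸ suc i₂) p) ⟩
      (E -S ((X^ (i₁ * q) *S X^ (i₂ * p)) *S X)) -S (X *S ((X^ (i₁ * q) *S X^ (i₂ * p)) *S (X^ p *S geomSum (q₂ ∸ suc i₂) p)))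
        ≈⟨ +-cong (+-cong (≋-refl {E}) (-‿cong (*-cong (X^-+ (i₁ * q) (i₂ * p)) (≋-refl {X}))))
                  (-‿cong (*-cong (≋-refl {X}) (*-cong (X^-+ (i₁ * q) (i₂ * p)) (≋-refl {X^ p *S geomSum (q₂ ∸ suc i₂) p})))) ⟩
      (E -S (X^ e *S X)) -S (X *S (X^ e *S (X^ p *S geomSum (q₂ ∸ suc i₂) p))) ∎
      where open ≋-Reasoning

  h≡rhs : h ≡ rhs mod-X^ suc u
  h≡rhs k k<1+u = begin
    h k                  ≡⟨ coeff h≋closed+tail k ⟩
    closed k ℤ.+ tail k  ≡⟨ cong (ℤ._+_ (closed k)) (tail≡0 k k<1+u) ⟩
    closed k ℤ.+ + 0     ≡⟨ ℤP.+-identityʳ (closed k) ⟩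
    closed k             ≡⟨ coeff rhs≋closed k ⟨
    rhs k                ∎
    where open ≡-Reasoning

  rhs-degree : Degree≤ u rhs
  rhs-degree = Degree≤-+ (Degree≤-+ (Degree≤-weaken z≤n (Degree≤-X^ 0)) (Degree≤-sumS (i₁ + 1) summand-degree))
                         (Degree≤-neg E-degree)
    where
    W-degree : ∀ {a} → a < p → Degree≤ (p ∸ a) (W a)
    W-degree a<p = Degree≤-+ (Degree≤-neg (Degree≤-weaken (ℕP.m<n⇒0<n∸m a<p) (Degree≤-X^ 1))) (Degree≤-X^ _)
    summand-degree : ∀ a → a < i₁ + 1 → Degree≤ u (summand a)
    summand-degree a a<i₁+1 =
      Degree≤-≋ (sumS-*ˡ (Bsize i₁ q₂ i₂ a) (X^ (a * q)) (λ b → X^ (b * p) *S W a))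
        (Degree≤-sumS (Bsize i₁ q₂ i₂ a) (λ b b<B → Degree≤-weaken (summand-exponent≤u a≤i₁ b<B)
          (Degree≤-* (Degree≤-X^ (a * q)) (Degree≤-* (Degree≤-X^ (b * p)) (W-degree (ℕP.≤-<-trans a≤i₁ i₁<p))))))
      where
      a≤i₁ : a ≤ i₁
      a≤i₁ = ℕP.≤-pred (subst (a <_) (ℕP.+-comm i₁ 1) a<i₁+1)
    E-degree : Degree≤ u E
    E-degree with i₁ ℕ.<? i₃
    ... | yes i₁<i₃ = Degree≤-≋ (*-cong (≋-refl {X^ e}) (≋-sym (T-X-large (i₁<i₃⇒1<s i₁<i₃))))
                                (Degree≤-weaken (i₁<i₃⇒e+1≤u i₁<i₃) (Degree≤-* (Degree≤-X^ e) (Degree≤-X^ 1)))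
    ... | no  i₁≮i₃ = Degree≤-≋ (≋-sym (≋-trans (*-cong (≋-refl {X^ e}) (T-X-small (i₃≤i₁⇒s≤1 (ℕP.≮⇒≥ i₁≮i₃))))
                                                (zeroʳ (X^ e))))
                                (Degree≤-0S u)

m≤n∸k⇒m<n : ∀ {m n k} → 0 < k → k ≤ n → m ≤ n ∸ k → m < n
m≤n∸k⇒m<n 0<k k≤n m≤n∸k = ℕP.≤-<-trans m≤n∸k (ℕP.∸-monoʳ-< 0<k k≤n)

quotient-positive : ∀ {p} q₂ → 1 < p → p < suc (q₂ * p) → 0 < q₂
quotient-positive zero    (s≤s (s≤s _)) (s≤s ())
quotient-positive (suc _) _             _ = s≤s z≤n

lemma4 : (p₁ p₂ p₃ : ℕ) → Prime p₁ → Prime p₂ → Prime p₃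
         → ¬ (2 ∣ p₁) → ¬ (2 ∣ p₂) → ¬ (2 ∣ p₃)
         → p₁ < p₂ → p₂ < p₃
         → p₁ ∣ p₂ ∸ 1 → (p₁ * p₂) ∣ p₃ ∸ 1
         → (q₂ : ℕ) → p₂ ∸ 1 ≡ q₂ * p₁
         → (i₁ i₂ i₃ : ℕ) → i₁ ≤ p₁ ∸ 2 → i₂ ≤ q₂ ∸ 1 → i₃ ≤ p₁ ∸ 1
         → T (+ (i₁ * (p₂ ∸ 1) + i₂ * p₁ + i₃ + 1)) (Φ (p₁ * p₂))
           ≈S
           ((1S +S sumS (i₁ + 1) (λ a → X^ (a * p₂) *S
                     sumS (Bsize i₁ q₂ i₂ a) (λ b → X^ (b * p₁) *S ((-S X) +S X^ (p₁ ∸ a)))))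
            -S (X^ (i₁ * p₂ + i₂ * p₁) *S T ((+ i₃ ℤ.- + i₁) ℤ.+ + 1) X))
lemma4 p₁ zero _ _ _ _ _ _ _ () _ _ _ _ _ _ _ _ _ _ _
lemma4 p₁ (suc .(q₂ * p₁)) _ p₁-prime p₂-prime _ _ _ _ p₁<p₂ _ _ _ q₂ refl i₁ i₂ i₃ i₁≤p₁-2 i₂≤q₂-1 i₃≤p₁-1 =
  T-unique (≡-mod-trans Φ≡h h≡rhs) rhs-degree
  where
  1<p₁ : 1 < p₁
  1<p₁ = prime⇒>1 p₁-prime
  open Expansion p₁ q₂ i₁ i₂ i₃
    (m≤n∸k⇒m<n (s≤s z≤n) 1<p₁ i₁≤p₁-2)
    (m≤n∸k⇒m<n (s≤s z≤n) (quotient-positive q₂ 1<p₁ p₁<p₂) i₂≤q₂-1)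
    (m≤n∸k⇒m<n (s≤s z≤n) (ℕP.<⇒≤ 1<p₁) i₃≤p₁-1)
  Φ≡h : Φ (p₁ * q) ≡ h mod-X^ suc u
  Φ≡h = ≡-mod-weaken u<pq
          (≡-mod-trans (Φ-semiprime p₁-prime p₂-prime p₁<p₂) (≋⇒≡-mod (semiprimeSeries-≡1-mod q₂ 0<p)))
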